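{- Let $G=K_{r_1,\ldots,r_k}$ be a complete $k$-partite graph with an odd number $n=\sum_i r_i$ of vertices, and consider the graph coloring game on $G$ in which Alice uses strategy $(A3)$. Then $(A3)$ is a correct strategy, i.e. it specifies a move in every possible state of the game in which it is Alice's turn; in particular, before each of Alice's moves there is at least one partially colored part or at least one uncolored part of odd size.
   Context: Graph coloring game: given a graph $G$ and a finite set $C$ of colors, Alice and Bob alternately (Alice first) pick an uncolored vertex and give it a legal color, i.e. a color from $C$ not used on any neighbor. The game ends when all vertices are colored (Alice wins) or when no uncolored vertex has a legal color (Bob wins). $K_{r_1,\ldots,r_k}$ denotes the complete $k$-partite graph with parts (independent sets) $V_1,\ldots,V_k$, $|V_i|=r_i\ge1$, $r_1\ge\cdots\ge r_k$, every two vertices in different parts adjacent; the paper assumes that if $k\ge2$ then $r_1\ge 2$. A part is uncolored / partially colored / fully colored if none / some but not all / all of its vertices are colored. A "new color" is a color of $C$ not yet used on any vertex. Strategy $(A3)$ for Alice (for $n$ odd): (1) in her first move, pick an uncolored vertex of a part $V_i$ whose size $r_i$ is the smallest odd part size, and assign it a new color; (2) otherwise, if Bob's last move was at a vertex of some partially colored part $V_i$, pick another uncolored vertex of $V_i$ and give it the color Bob just used; (3) otherwise, if there is a partially colored part $V_i$, pick any uncolored vertex of it and give it a color already used on some vertex of $V_i$; (4) otherwise, pick any vertex of an uncolored part $V_i$ whose size is the smallest odd size among uncolored parts, and assign it a new color. -}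

module Defs where

open import Data.Nat using (ℕ; _≤_; _%_)
open import Data.Fin using (Fin)
open import Data.List using (map; allFin)
open import Data.Nat.ListAction using (sum)
open import Data.Maybe using (Maybe; just; nothing)
open import Data.Product using (Σ; ∃; _×_; _,_; proj₁; proj₂)
open import Data.Sum using (_⊎_)
open import Relation.Binary.PropositionalEquality using (_≡_; _≢_)
open import Relation.Nullary using (¬_)
open import Data.Fin using (_≟_)
open import Relation.Nullary using (yes; no)
open import Relation.Binary.Definitions using (DecidableEquality)
open import Data.Product.Properties using (≡-dec)

Odd : ℕ → Set
Odd n = n % 2 ≡ 1

total : ∀ {k} → (Fin k → ℕ) → ℕ
total {k} r = sum (map r (allFin k))

module Game {k : ℕ} (r : Fin k → ℕ) (c : ℕ) where

  -- vertex (i , j) is the j-th vertex of part V_i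
  Vertex : Set
  Vertex = Σ (Fin k) (λ i → Fin (r i))

  part : Vertex → Fin k
  part = proj₁

  Adj : Vertex → Vertex → Set
  Adj v w = part v ≢ part w

  Colouring : Set
  Colouring = Vertex → Maybe (Fin c)

  empty : Colouring
  empty _ = nothing

  Move : Set
  Move = Vertex × Fin c

  Legal : Colouring → Move → Set
  Legal s (v , col) = (s v ≡ nothing) × (∀ w → Adj v w → s w ≢ just col)

  _≟V_ : DecidableEquality Vertex
  _≟V_ = ≡-dec _≟_ _≟_

  apply : Colouring → Move → Colouring
  apply s (v , col) w with v ≟V w
  ... | yes _ = just col
  ... | no _ = s w

  Coloured : Colouring → Vertex → Set
  Coloured s v = ∃ λ col → s v ≡ just col

  NewColour : Colouring → Fin c → Set
  NewColour s col = ∀ w → s w ≢ just col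

  UncolouredPart : Colouring → Fin k → Set
  UncolouredPart s i = ∀ (j : Fin (r i)) → s (i , j) ≡ nothing

  PartiallyColouredPart : Colouring → Fin k → Set
  PartiallyColouredPart s i =
    (∃ λ (j : Fin (r i)) → Coloured s (i , j)) × (∃ λ (j : Fin (r i)) → s (i , j) ≡ nothing)

  SmallestOdd : Fin k → Set
  SmallestOdd i = Odd (r i) × (∀ i' → Odd (r i') → r i ≤ r i')

  SmallestOddUncoloured : Colouring → Fin k → Set
  SmallestOddUncoloured s i =
    UncolouredPart s i × Odd (r i) × (∀ i' → UncolouredPart s i' → Odd (r i') → r i ≤ r i')

  Ongoing : Colouring → Set
  Ongoing s = ∃ λ m → Legal s m

  -- A3 lastBob s m : in position s (Alice to move), where
  -- lastBob is Bob's last move (nothing before Alice's first move), the move m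
  -- is one prescribed by (A3).  The cases are tried in order (1)-(4).
  data A3 : Maybe Move → Colouring → Move → Set where
    a3-1 : ∀ {s i j col} → SmallestOdd i → NewColour s col →
           A3 nothing s ((i , j) , col)
    a3-2 : ∀ {s i j bj bcol} → PartiallyColouredPart s i →
           s (i , j) ≡ nothing →
           A3 (just ((i , bj) , bcol)) s ((i , j) , bcol)
    a3-3 : ∀ {s b i j j' col} →
           ¬ PartiallyColouredPart s (part (proj₁ b)) →
           PartiallyColouredPart s i → s (i , j) ≡ nothing →
           s (i , j') ≡ just col →
           A3 (just b) s ((i , j) , col)
    a3-4 : ∀ {s b i j col} →
           ¬ PartiallyColouredPart s (part (proj₁ b)) →
           (∀ i' → ¬ PartiallyColouredPart s i') →
           SmallestOddUncoloured s i → NewColour s col →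
           A3 (just b) s ((i , j) , col)

  -- Positions in which it is Alice's turn, reachable when Alice plays (A3)
  -- and Bob plays arbitrary legal moves; the second index is Bob's last move.
  data ReachableA3 : Colouring → Maybe Move → Set where
    start : ReachableA3 empty nothing
    round : ∀ {s lastBob a b} → ReachableA3 s lastBob →
            Legal s a → A3 lastBob s a →
            Legal (apply s a) b →
            ReachableA3 (apply (apply s a) b) (just b)

-- Every round of the game (a move of Alice followed by one of Bob) colours two vertices, so
-- before each move of Alice an even number of vertices is coloured. If no part is partially
-- coloured, every part is either fully coloured or uncoloured; as n is odd, the uncoloured
-- parts cannot all have even size. Hence rule (4) always finds a part, and a new colour exists
-- because Alice still has a legal move (v , col): the part of v is uncoloured and col is absent
-- from all other parts. Rules (2) and (3) reuse a colour of the same part, which is legal since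
-- the colouring stays proper.
module Submission where

open import Defs
open import Data.Nat using (ℕ; zero; suc; _+_; _%_; _≤_; _<_; _≟_; parity)
open import Data.Nat.Properties using (+-0-commutativeMonoid; _<?_; ≮⇒≥)
open import Data.Nat.Induction using (<-wellFounded)
open import Algebra.Properties.CommutativeMonoid.Sum +-0-commutativeMonoid
  using (sum; sum-cong-≗; sum-remove; sum-replicate-zero)
import Data.Nat.ListAction as List
open import Data.Parity.Base using (0ℙ; 1ℙ)
import Data.Parity.Base as ℙ
open import Data.Parity.Properties using (+-homo-+) renaming (_≟_ to _≟ℙ_)
open import Data.Fin using (Fin; zero; suc; toℕ) renaming (_≟_ to _≟F_)
open import Data.Fin.Properties using (any?; all?; punchInᵢ≢i)
open import Data.Vec.Functional using (removeAt)
open import Data.List using (tabulate)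
open import Data.List.Properties using (map-tabulate)
open import Data.Maybe using (Maybe; just; nothing)
open import Data.Maybe.Properties using (just-injective)
import Data.Maybe.Properties as Maybe
open import Data.Product using (∃; _×_; _,_; proj₁; proj₂)
open import Data.Product.Properties.WithK using (,-injectiveʳ)
open import Data.Sum using (_⊎_; inj₁; inj₂)
open import Data.Empty using (⊥-elim)
open import Function using (_∘_; id)
open import Induction.WellFounded using (Acc; acc)
open import Relation.Nullary using (¬_; Dec; yes; no)
open import Relation.Nullary.Negation using (¬∃⟶∀¬)
open import Relation.Nullary.Decidable using (_×-dec_)
open import Relation.Unary using (Pred; Decidable)
open import Relation.Binary.PropositionalEquality
  using (_≡_; _≢_; refl; sym; trans; cong; cong₂; subst; module ≡-Reasoning)

open ≡-Reasoning

sum-ones : ∀ n → sum {n} (λ _ → 1) ≡ n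
sum-ones zero    = refl
sum-ones (suc n) = cong suc (sum-ones n)

sum-incrementAt : ∀ {n} (f g : Fin n → ℕ) i → g i ≡ suc (f i) →
                  (∀ j → j ≢ i → g j ≡ f j) → sum g ≡ suc (sum f)
sum-incrementAt {suc n} f g i gi≡1+fi g≗f = begin
  sum g                           ≡⟨ sum-remove {i = i} g ⟩
  g i + sum (removeAt g i)        ≡⟨ cong₂ _+_ gi≡1+fi (sum-cong-≗ λ j → g≗f _ (punchInᵢ≢i i j)) ⟩
  suc (f i + sum (removeAt f i))  ≡⟨ cong suc (sum-remove {i = i} f) ⟨
  suc (sum f)                     ∎

sum-tabulate : ∀ {n} (f : Fin n → ℕ) → List.sum (tabulate f) ≡ sum f
sum-tabulate {zero}  f = refl
sum-tabulate {suc n} f = cong (f zero +_) (sum-tabulate (f ∘ suc))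

total≡sum : ∀ {k} (r : Fin k → ℕ) → total r ≡ sum r
total≡sum r = trans (cong List.sum (map-tabulate id r)) (sum-tabulate r)

odd⇒parity≡1ℙ : ∀ n → Odd n → parity n ≡ 1ℙ
odd⇒parity≡1ℙ 1             _   = refl
odd⇒parity≡1ℙ (suc (suc n)) odd = odd⇒parity≡1ℙ n odd

parity≢0ℙ⇒odd : ∀ n → parity n ≢ 0ℙ → Odd n
parity≢0ℙ⇒odd zero          p≢0 = ⊥-elim (p≢0 refl)
parity≢0ℙ⇒odd 1             _   = refl
parity≢0ℙ⇒odd (suc (suc n)) p≢0 = parity≢0ℙ⇒odd n p≢0

parity-sum-differs : ∀ {n} (f g : Fin n → ℕ) → parity (sum f) ≢ parity (sum g) →
                     ∃ λ i → parity (f i) ≢ parity (g i)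
parity-sum-differs {zero}  f g ne = ⊥-elim (ne refl)
parity-sum-differs {suc n} f g ne with parity (f zero) ≟ℙ parity (g zero)
... | no  ne₀ = zero , ne₀
... | yes eq₀ = let i , neᵢ = parity-sum-differs (f ∘ suc) (g ∘ suc) (ne ∘ extend) in suc i , neᵢ
  where
  extend : parity (sum (f ∘ suc)) ≡ parity (sum (g ∘ suc)) → parity (sum f) ≡ parity (sum g)
  extend eq = begin
    parity (f zero + sum (f ∘ suc))            ≡⟨ +-homo-+ (f zero) _ ⟩
    parity (f zero) ℙ.+ parity (sum (f ∘ suc)) ≡⟨ cong₂ ℙ._+_ eq₀ eq ⟩
    parity (g zero) ℙ.+ parity (sum (g ∘ suc)) ≡⟨ +-homo-+ (g zero) _ ⟨
    parity (g zero + sum (g ∘ suc))            ∎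

minimal-witness : ∀ {k p} (f : Fin k → ℕ) {P : Pred (Fin k) p} → Decidable P →
                  ∀ {i} → P i → ∃ λ m → P m × (∀ j → P j → f m ≤ f j)
minimal-witness f {P} P? {i} pᵢ = descend i (<-wellFounded (f i)) pᵢ
  where
  descend : ∀ i → Acc _<_ (f i) → P i → ∃ λ m → P m × (∀ j → P j → f m ≤ f j)
  descend i (acc smaller) pᵢ with any? (λ j → P? j ×-dec f j <? f i)
  ... | yes (j , pⱼ , fj<fi) = descend j (smaller fj<fi) pⱼ
  ... | no  none             = i , pᵢ , λ j pⱼ → ≮⇒≥ (λ fj<fi → none (j , pⱼ , fj<fi))

odd-inhabited : ∀ n → Odd n → Fin n
odd-inhabited (suc n) _ = zero

module _ {k : ℕ} (r : Fin k → ℕ) (c : ℕ) where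
  open Game r c

  Proper : Colouring → Set
  Proper s = ∀ v w col → Adj v w → s v ≡ just col → s w ≢ just col

  apply-≡ : ∀ s v col → apply s (v , col) v ≡ just col
  apply-≡ s v col with v ≟V v
  ... | yes _   = refl
  ... | no  v≢v = ⊥-elim (v≢v refl)

  apply-≢ : ∀ s v col w → v ≢ w → apply s (v , col) w ≡ s w
  apply-≢ s v col w v≢w with v ≟V w
  ... | yes v≡w = ⊥-elim (v≢w v≡w)
  ... | no  _   = refl

  apply-just-inv : ∀ s v c₀ u {col} → apply s (v , c₀) u ≡ just col →
                   (v ≡ u × c₀ ≡ col) ⊎ (s u ≡ just col)
  apply-just-inv s v c₀ u eq with v ≟V u
  ... | yes v≡u = inj₁ (v≡u , just-injective eq)
  ... | no  _   = inj₂ eq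

  apply-proper : ∀ {s m} → Proper s → Legal s m → Proper (apply s m)
  apply-proper {s} {v₀ , c₀} proper (_ , legal) v w col adj sv sw
    with apply-just-inv s v₀ c₀ v sv | apply-just-inv s v₀ c₀ w sw
  ... | inj₁ (refl , _)    | inj₁ (refl , _)    = adj refl
  ... | inj₁ (refl , refl) | inj₂ sw′           = legal w adj sw′
  ... | inj₂ sv′           | inj₁ (refl , refl) = legal v (adj ∘ sym) sv′
  ... | inj₂ sv′           | inj₂ sw′           = proper v w col adj sv′ sw′

  indicator : Maybe (Fin c) → ℕ
  indicator nothing  = 0
  indicator (just _) = 1

  colouredIn : Colouring → Fin k → ℕ
  colouredIn s i = sum λ j → indicator (s (i , j))

  colouredCount : Colouring → ℕ
  colouredCount s = sum (colouredIn s)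

  colouredCount-empty : colouredCount empty ≡ 0
  colouredCount-empty = trans (sum-cong-≗ (sum-replicate-zero ∘ r)) (sum-replicate-zero k)

  colouredCount-apply : ∀ s i j col → s (i , j) ≡ nothing →
                        colouredCount (apply s ((i , j) , col)) ≡ suc (colouredCount s)
  colouredCount-apply s i j col sv =
    sum-incrementAt (colouredIn s) (colouredIn s′) i in-part off-part
    where
    s′ = apply s ((i , j) , col)
    in-part : colouredIn s′ i ≡ suc (colouredIn s i)
    in-part = sum-incrementAt _ _ j
      (trans (cong indicator (apply-≡ s (i , j) col)) (cong (suc ∘ indicator) (sym sv)))
      (λ j′ j′≢j → cong indicator (apply-≢ s _ col (i , j′) (j′≢j ∘ sym ∘ ,-injectiveʳ)))
    off-part : ∀ i′ → i′ ≢ i → colouredIn s′ i′ ≡ colouredIn s i′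
    off-part i′ i′≢i =
      sum-cong-≗ λ j′ → cong indicator (apply-≢ s _ col (i′ , j′) (i′≢i ∘ sym ∘ cong proj₁))

  colouredIn-uncoloured : ∀ {s i} → UncolouredPart s i → colouredIn s i ≡ 0
  colouredIn-uncoloured {s} {i} uncoloured =
    trans (sum-cong-≗ (cong indicator ∘ uncoloured)) (sum-replicate-zero (r i))

  colouredIn-full : ∀ {s i} → (∀ j → s (i , j) ≢ nothing) → colouredIn s i ≡ r i
  colouredIn-full {s} {i} full = trans (sum-cong-≗ one) (sum-ones (r i))
    where
    one : ∀ j → indicator (s (i , j)) ≡ 1
    one j with s (i , j) | full j
    ... | nothing | sv≢nothing = ⊥-elim (sv≢nothing refl)
    ... | just _  | _          = refl

  EvenlyColoured : Colouring → Set
  EvenlyColoured s = parity (colouredCount s) ≡ 0ℙ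

  reachable-invariant : ∀ {s lastBob} → ReachableA3 s lastBob → Proper s × EvenlyColoured s
  reachable-invariant start = (λ _ _ _ _ ()) , cong parity colouredCount-empty
  reachable-invariant (round {s} {_} {(i , j) , col} {(i′ , j′) , col′} reachable legalA _ legalB)
    with proper , even ← reachable-invariant reachable =
    apply-proper (apply-proper proper legalA) legalB ,
    trans (cong parity (trans (colouredCount-apply _ i′ j′ col′ (proj₁ legalB))
                              (cong suc (colouredCount-apply s i j col (proj₁ legalA)))))
          even

  coloured? : ∀ (s : Colouring) v → Dec (Coloured s v)
  coloured? s v with s v
  ... | just col = yes (col , refl)
  ... | nothing  = no λ { (_ , ()) }

  uncoloured? : ∀ (s : Colouring) v → Dec (s v ≡ nothing)
  uncoloured? s v = Maybe.≡-dec _≟F_ (s v) nothing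

  partiallyColoured? : ∀ (s : Colouring) i → Dec (PartiallyColouredPart s i)
  partiallyColoured? s i =
    any? (λ j → coloured? s (i , j)) ×-dec any? (λ j → uncoloured? s (i , j))

  uncolouredPart? : ∀ (s : Colouring) i → Dec (UncolouredPart s i)
  uncolouredPart? s i = all? (λ j → uncoloured? s (i , j))

  odd? : ∀ n → Dec (Odd n)
  odd? n = n % 2 ≟ 1

  ¬partial⇒uncoloured : ∀ {s i j} → ¬ PartiallyColouredPart s i → s (i , j) ≡ nothing →
                        UncolouredPart s i
  ¬partial⇒uncoloured {s} {i} {j} ¬partial sv j′ with s (i , j′) in sv′
  ... | just col = ⊥-elim (¬partial ((j′ , col , sv′) , j , sv))
  ... | nothing  = refl

  empty-¬partial : ∀ i → ¬ PartiallyColouredPart empty i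
  empty-¬partial i ((_ , _ , ()) , _)

  mismatched-part-odd : ∀ {s i} → ¬ PartiallyColouredPart s i →
                        parity (r i) ≢ parity (colouredIn s i) → UncolouredPart s i × Odd (r i)
  mismatched-part-odd {s} {i} ¬partial ne with any? (λ j → uncoloured? s (i , j))
  ... | yes (j , sv) = uncoloured , parity≢0ℙ⇒odd (r i) (ne ∘ flip-zero)
    where
    uncoloured : UncolouredPart s i
    uncoloured = ¬partial⇒uncoloured {s} ¬partial sv
    flip-zero : parity (r i) ≡ 0ℙ → parity (r i) ≡ parity (colouredIn s i)
    flip-zero p = trans p (cong parity (sym (colouredIn-uncoloured {s} uncoloured)))
  ... | no none = ⊥-elim (ne (cong parity (sym (colouredIn-full {s} λ j sv → none (j , sv)))))

  parity-total≢parity-colouredCount : ∀ {s} → Odd (total r) → EvenlyColoured s →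
                                      parity (sum r) ≢ parity (colouredCount s)
  parity-total≢parity-colouredCount odd even eq
    with () ← trans (sym (odd⇒parity≡1ℙ (sum r) (subst Odd (total≡sum r) odd))) (trans eq even)

  odd-uncolouredPart : ∀ {s} → Odd (total r) → EvenlyColoured s →
                       (∀ i → ¬ PartiallyColouredPart s i) →
                       ∃ λ i → UncolouredPart s i × Odd (r i)
  odd-uncolouredPart {s} odd even ¬partial =
    let i , ne = parity-sum-differs r (colouredIn s)
                   (parity-total≢parity-colouredCount {s} odd even)
    in  i , mismatched-part-odd {s} (¬partial i) ne

  newColour-exists : ∀ {s} → Ongoing s → (∀ i → ¬ PartiallyColouredPart s i) → ∃ (NewColour s)
  newColour-exists {s} (((i , j) , col) , sv , legal) ¬partial = col , new
    where
    new : NewColour s col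
    new (i′ , j′) eq with i ≟F i′
    ... | yes refl with () ← trans (sym (¬partial⇒uncoloured {s} (¬partial i) sv j′)) eq
    ... | no  i≢i′ = legal (i′ , j′) i≢i′ eq

  legal-new : ∀ {s v col} → s v ≡ nothing → NewColour s col → Legal s (v , col)
  legal-new sv new = sv , λ w _ → new w

  legal-reuse : ∀ {s i j j′ col} → Proper s → s (i , j) ≡ nothing → s (i , j′) ≡ just col →
                Legal s ((i , j) , col)
  legal-reuse {s} {i} {j} {j′} {col} proper sv sv′ = sv , λ w adj → proper (i , j′) w col adj sv′

  first-move : Odd (total r) → Ongoing empty → ∃ λ m → Legal empty m × A3 nothing empty m
  first-move odd ongoing
    with col , new ← newColour-exists {empty} ongoing empty-¬partial
       | _ , _ , oddᵢ ← odd-uncolouredPart {empty} odd (cong parity colouredCount-empty)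
                                           empty-¬partial
    with i , odd-i , smallest ← minimal-witness r {Odd ∘ r} (odd? ∘ r) oddᵢ
    = let v = i , odd-inhabited (r i) odd-i
      in  (v , col) , legal-new {empty} {v} refl new , a3-1 (odd-i , smallest) new

  reply : ∀ {s v col} → Proper s → EvenlyColoured s → Odd (total r) → s v ≡ just col →
          Ongoing s → ∃ λ m → Legal s m × A3 (just (v , col)) s m
  reply {s} {i , _} {col} proper even odd sv ongoing with partiallyColoured? s i
  ... | yes partial@(_ , j , sj) =
    ((i , j) , col) , legal-reuse {s} proper sj sv , a3-2 partial sj
  ... | no ¬partialᵢ with any? (partiallyColoured? s)
  ...   | yes (i′ , partial@((j′ , col′ , sj′) , j , sj)) =
    ((i′ , j) , col′) , legal-reuse {s} proper sj sj′ , a3-3 ¬partialᵢ partial sj sj′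
  ...   | no ¬∃partial
    with col′ , new ← newColour-exists {s} ongoing (¬∃⟶∀¬ ¬∃partial)
       | _ , uncolouredᵢ , oddᵢ ← odd-uncolouredPart {s} odd even (¬∃⟶∀¬ ¬∃partial)
    with i′ , (uncoloured , odd-i′) , smallest
           ← minimal-witness r (λ i → uncolouredPart? s i ×-dec odd? (r i)) (uncolouredᵢ , oddᵢ)
    = ((i′ , odd-inhabited (r i′) odd-i′) , col′) , legal-new {s} (uncoloured _) new ,
      a3-4 ¬partialᵢ (¬∃⟶∀¬ ¬∃partial) (uncoloured , odd-i′ , λ i u o → smallest i (u , o)) new

  a3-move : ∀ {s lastBob} → Odd (total r) → ReachableA3 s lastBob → Ongoing s →
            ∃ λ m → Legal s m × A3 lastBob s m
  a3-move odd start ongoing = first-move odd ongoing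
  a3-move odd reachable@(round {b = v , col} _ _ _ _) ongoing =
    let proper , even = reachable-invariant reachable
    in  reply proper even odd (apply-≡ _ v col) ongoing

  partial-or-odd-uncoloured : ∀ {s lastBob} → Odd (total r) → ReachableA3 s lastBob →
                              ∃ λ i → PartiallyColouredPart s i ⊎ (UncolouredPart s i × Odd (r i))
  partial-or-odd-uncoloured {s} odd reachable with any? (partiallyColoured? s)
  ... | yes (i , partial) = i , inj₁ partial
  ... | no ¬∃partial =
    let i , uncoloured-odd = odd-uncolouredPart {s} odd (proj₂ (reachable-invariant reachable))
                                                (¬∃⟶∀¬ ¬∃partial)
    in  i , inj₂ uncoloured-odd

lemma3 : (k : ℕ) (r : Fin k → ℕ) (c : ℕ) →
    (∀ i → 1 ≤ r i) →
    (∀ i j → toℕ i ≤ toℕ j → r j ≤ r i) →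
    (∀ (i : Fin k) → toℕ i ≡ 0 → 2 ≤ k → 2 ≤ r i) →
    Odd (total r) →
    ∀ s lastBob → Game.ReachableA3 r c s lastBob → Game.Ongoing r c s →
    (∃ λ m → Game.Legal r c s m × Game.A3 r c lastBob s m)
    × (∃ λ i → Game.PartiallyColouredPart r c s i
    ⊎ (Game.UncolouredPart r c s i × Odd (r i)))
lemma3 k r c _ _ _ odd s lastBob reachable ongoing =
  a3-move r c odd reachable ongoing , partial-or-odd-uncoloured r c odd reachable
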